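{- Let $t,r$ be positive integers, let $U\subset\{+,-\}^r$ be nonempty, and let $J\subset[r]$ be the set of coordinates $j$ at which all vectors of $U$ agree (i.e., $u_j$ is the same for all $u\in U$). Then the length of the longest common subsequence of all the words $\pi(u)$, $u\in U$, equals $t^{|J|}$.
   Context: For $u\in\{+,-\}^r$ (viewed as a vector of signs $\pm1$) and $a\in[t]^r$, let $ua=(u_1a_1,\dots,u_ra_r)\in\{ -t,\dots,t\}^r$. The permutation $\pi(u)$ is the word over the alphabet $[t]^r$ in which each symbol of $[t]^r$ occurs exactly once, and $a$ precedes $b$ iff $ua$ is lexicographically smaller than $ub$. -}

module Defs where

open import Data.Nat using (ℕ; suc; _≤_; _^_)
open import Data.Fin using (Fin; toℕ)
open import Data.Fin.Subset using (Subset; _∈_; ∣_∣)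
open import Data.Integer using (ℤ; +_; -_) renaming (_<_ to _<ℤ_)
open import Data.Vec using (Vec; zipWith; lookup)
open import Data.Vec.Relation.Binary.Lex.Strict using (Lex-<)
open import Data.List using (List; []; _∷_; _++_; length)
import Data.List.Membership.Propositional as LM
open import Data.List.Relation.Unary.Unique.Propositional using (Unique)
open import Data.List.Relation.Binary.Sublist.Propositional using (_⊆_)
open import Data.Product using (Σ; ∃; _×_)
open import Function.Bundles using (_⇔_)
open import Relation.Binary.PropositionalEquality using (_≡_)

data Sign : Set where
  plus minus : Sign

SignVec : ℕ → Set
SignVec r = Vec Sign r

-- symbols: elements of [t]^r; Fin t represents [t] via i ↦ toℕ i + 1
Sym : ℕ → ℕ → Set
Sym t r = Vec (Fin t) r

signed : {t : ℕ} → Sign → Fin t → ℤ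
signed plus  i = + suc (toℕ i)
signed minus i = - (+ suc (toℕ i))

_·_ : {t r : ℕ} → SignVec r → Sym t r → Vec ℤ r
u · a = zipWith signed u a

_<lex_ : {r : ℕ} → Vec ℤ r → Vec ℤ r → Set
x <lex y = Lex-< _≡_ _<ℤ_ x y

Precedes : {A : Set} → List A → A → A → Set
Precedes w a b = ∃ λ xs → ∃ λ ys → ∃ λ zs → w ≡ xs ++ (a ∷ ys ++ (b ∷ zs))

IsPi : {t r : ℕ} → SignVec r → List (Sym t r) → Set
IsPi {t} {r} u w =
  Unique w × (∀ (a : Sym t r) → a LM.∈ w) ×
  (∀ (a b : Sym t r) → Precedes w a b ⇔ ((u · a) <lex (u · b)))

Agree : {r : ℕ} → List (SignVec r) → Fin r → Set
Agree U j = ∀ u v → u LM.∈ U → v LM.∈ U → lookup u j ≡ lookup v j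

CommonSubseq : {t r : ℕ} → List (SignVec r) → (SignVec r → List (Sym t r)) →
               List (Sym t r) → Set
CommonSubseq U π w = ∀ u → u LM.∈ U → w ⊆ π u

LCSLength : {t r : ℕ} → List (SignVec r) → (SignVec r → List (Sym t r)) → ℕ → Set
LCSLength U π n =
  (∃ λ w → CommonSubseq U π w × length w ≡ n) ×
  (∀ w → CommonSubseq U π w → length w ≤ n)

-- A common subsequence w of all π(u), u ∈ U, lists any two of its letters in an order shared by all u.
-- The first coordinate where two letters differ decides their order in every π(u), so all u ∈ U carry the
-- same sign there and it lies in J: letters of w already differ on J, and |w| ≤ t^|J|. Conversely, among
-- the t^|J| letters equal to 1 off J, comparisons are never decided off J, where the signs of U may differ,
-- so their order in π(u) is the same for all u ∈ U and they form a common subsequence.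
module Submission where

open import Defs
open import Data.Nat using (ℕ; zero; suc; _≤_; _^_; _*_; _+_; s≤s; z≤n)
open import Data.Nat.Properties
  using (≤-trans; ≤-reflexive; ≤-antisym; suc-injective; <-asym; module ≤-Reasoning)
open import Data.Fin using (Fin; zero; suc; _≟_)
import Data.Fin.Properties as Fin
open import Data.Bool using (if_then_else_)
open import Data.Integer using (+<+; -<-) renaming (_<_ to _<ℤ_)
import Data.Integer.Properties as ℤ
open import Data.Vec using ([]; _∷_; lookup; zipWith)
open import Data.Fin.Subset using (Subset; Side; inside; outside; ∣_∣)
open import Data.Vec.Properties using (∷-injective; ∷-injectiveˡ; ∷-injectiveʳ; ≡-dec; lookup-zipWith)
open import Data.Vec.Relation.Binary.Lex.Core using (this; next; base)
open import Data.List using (List; []; _∷_; [_]; length; map; filter; allFin; cartesianProductWith)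
open import Data.List.Properties using (length-map; length-++; length-tabulate; length-removeAt′)
open import Data.List.Relation.Unary.Any using (here; there; index; _─_)
import Data.List.Relation.Unary.All as All
import Data.List.Relation.Unary.All.Properties as All
open import Data.List.Relation.Unary.AllPairs using ([]; _∷_)
open import Data.List.Relation.Unary.Unique.Propositional using (Unique)
import Data.List.Relation.Unary.Unique.Propositional.Properties as Unique
open import Data.List.Relation.Binary.Sublist.Propositional
  using (_⊆_; []; _∷_; _∷ʳ_; minimum; ⊆-trans; to∈; from∈)
open import Data.List.Relation.Binary.Sublist.Propositional.Properties
  using (All-resp-⊆; ∷⁻; ∷ˡ⁻; ∷ʳ⁻; ++⁺; filter-⊆)
open import Data.Product using (∃; _×_; _,_; proj₁; proj₂)
open import Data.Sum using (_⊎_; inj₁; inj₂)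
open import Data.Empty using (⊥-elim)
open import Function using (_∘_)
open import Function.Bundles using (_⇔_; Equivalence)
open import Relation.Nullary using (Dec; yes; no)
open import Relation.Binary.PropositionalEquality
  using (_≡_; _≢_; refl; sym; trans; cong; cong₂; module ≡-Reasoning)

module Lists {A : Set} where

  open import Data.List.Membership.Propositional using (_∈_)
  open import Data.List.Membership.Propositional.Properties using (∈-∃++)

  private variable
    a b x y : A
    xs ys w : List A

  Precedes⇒pair⊆ : Precedes w a b → a ∷ b ∷ [] ⊆ w
  Precedes⇒pair⊆ (xs , ys , zs , refl) = ++⁺ (minimum xs) (refl ∷ ++⁺ (minimum ys) (refl ∷ minimum zs))

  pair⊆⇒Precedes : a ∷ b ∷ [] ⊆ w → Precedes w a b
  pair⊆⇒Precedes (y ∷ʳ p) with xs , ys , zs , refl ← pair⊆⇒Precedes p = y ∷ xs , ys , zs , refl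
  pair⊆⇒Precedes (refl ∷ p) with ys , zs , refl ← ∈-∃++ (to∈ p) = [] , ys , zs , refl

  pair⊆-total : a ∈ w → b ∈ w → a ≢ b → a ∷ b ∷ [] ⊆ w ⊎ b ∷ a ∷ [] ⊆ w
  pair⊆-total (here refl) (here refl) a≢b = ⊥-elim (a≢b refl)
  pair⊆-total (here refl) (there b∈w) _   = inj₁ (refl ∷ from∈ b∈w)
  pair⊆-total (there a∈w) (here refl) _   = inj₂ (refl ∷ from∈ a∈w)
  pair⊆-total {w = y ∷ _} (there a∈w) (there b∈w) a≢b with pair⊆-total a∈w b∈w a≢b
  ... | inj₁ p = inj₁ (y ∷ʳ p)
  ... | inj₂ p = inj₂ (y ∷ʳ p)

  Unique-resp-⊆ : xs ⊆ ys → Unique ys → Unique xs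
  Unique-resp-⊆ [] []                  = []
  Unique-resp-⊆ (y ∷ʳ p) (_ ∷ !ys)     = Unique-resp-⊆ p !ys
  Unique-resp-⊆ (refl ∷ p) (y∉ ∷ !ys)  = All-resp-⊆ p y∉ ∷ Unique-resp-⊆ p !ys

  Unique-map⁺ : ∀ {B : Set} {f : A → B} →
                (∀ {x y} → x ∈ xs → y ∈ xs → f x ≡ f y → x ≡ y) →
                Unique xs → Unique (map f xs)
  Unique-map⁺ {[]} _ [] = []
  Unique-map⁺ {x ∷ xs} inj (x∉ ∷ !xs) =
    All.map⁺ (All.tabulate λ y∈ fx≡fy → All.lookup x∉ y∈ (inj (here refl) (there y∈) fx≡fy))
    ∷ Unique-map⁺ (λ x∈ y∈ → inj (there x∈) (there y∈)) !xs

  ∈-─ : (x∈ : x ∈ ys) → y ∈ ys → x ≢ y → y ∈ (ys ─ x∈)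
  ∈-─ (here refl) (here refl) x≢y = ⊥-elim (x≢y refl)
  ∈-─ (here refl) (there y∈)  _   = y∈
  ∈-─ (there _)   (here refl) _   = here refl
  ∈-─ (there x∈)  (there y∈)  x≢y = there (∈-─ x∈ y∈ x≢y)

  Unique⇒length≤ : Unique xs → (∀ {x} → x ∈ xs → x ∈ ys) → length xs ≤ length ys
  Unique⇒length≤ {[]} _ _ = z≤n
  Unique⇒length≤ {x ∷ xs} {ys} (x∉ ∷ !xs) xs⊆ys = ≤-trans
    (s≤s (Unique⇒length≤ !xs λ y∈ → ∈-─ x∈ys (xs⊆ys (there y∈)) (All.lookup x∉ y∈)))
    (≤-reflexive (sym (length-removeAt′ ys (index x∈ys))))
    where x∈ys = xs⊆ys (here refl)

  pair⊆⇒⊆ : Unique xs → Unique ys → (∀ {x} → x ∈ xs → x ∈ ys) →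
            (∀ {a b} → a ∷ b ∷ [] ⊆ xs → a ∷ b ∷ [] ⊆ ys) → xs ⊆ ys
  pair⊆⇒⊆ {[]} {ys} _ _ _ _ = minimum ys
  pair⊆⇒⊆ {x ∷ xs} {[]} _ _ mem _ with () ← mem (here refl)
  pair⊆⇒⊆ {x ∷ xs} {y ∷ ys} (x∉xs ∷ !xs) (y∉ys ∷ !ys) mem ord with mem (here refl)
  ... | here refl = refl ∷ pair⊆⇒⊆ !xs !ys mem′ ord′
    where
      mem′ : ∀ {c} → c ∈ xs → c ∈ ys
      mem′ c∈ = to∈ (∷⁻ (ord (refl ∷ from∈ c∈)))
      ord′ : ∀ {c d} → c ∷ d ∷ [] ⊆ xs → c ∷ d ∷ [] ⊆ ys
      ord′ p = ∷ʳ⁻ (λ c≡x → All.lookup x∉xs (to∈ p) (sym c≡x)) (ord (x ∷ʳ p))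
  ... | there x∈ys = y ∷ʳ pair⊆⇒⊆ (x∉xs ∷ !xs) !ys mem′ ord′
    where
      x≢y : x ≢ y
      x≢y x≡y = All.lookup y∉ys x∈ys (sym x≡y)
      mem′ : ∀ {c} → c ∈ x ∷ xs → c ∈ ys
      mem′ (here refl) = x∈ys
      mem′ (there c∈)  = to∈ (∷ˡ⁻ (∷ʳ⁻ x≢y (ord (refl ∷ from∈ c∈))))
      ord′ : ∀ {c d} → c ∷ d ∷ [] ⊆ x ∷ xs → c ∷ d ∷ [] ⊆ ys
      ord′ p = ∷ʳ⁻ (λ c≡y → All.lookup y∉ys (mem′ (to∈ p)) (sym c≡y)) (ord p)

length-cartesianProductWith : ∀ {A B C : Set} (f : A → B → C) xs ys →
  length (cartesianProductWith f xs ys) ≡ length xs * length ys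
length-cartesianProductWith f []       ys = refl
length-cartesianProductWith f (x ∷ xs) ys = trans (length-++ (map (f x) ys))
  (cong₂ _+_ (length-map (f x) ys) (length-cartesianProductWith f xs ys))

signed-injective : ∀ {t} s {x y : Fin t} → signed s x ≡ signed s y → x ≡ y
signed-injective plus  eq = Fin.toℕ-injective (suc-injective (ℤ.+-injective eq))
signed-injective minus eq = Fin.toℕ-injective (ℤ.-[1+-injective eq)

signed-<-determines-sign : ∀ {t} s s′ {x y : Fin t} →
  signed s x <ℤ signed s y → signed s′ x <ℤ signed s′ y → s ≡ s′
signed-<-determines-sign plus  plus  _         _         = refl
signed-<-determines-sign minus minus _         _         = refl
signed-<-determines-sign plus  minus (+<+ x<y) (-<- y<x) = ⊥-elim (<-asym x<y (s≤s y<x))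
signed-<-determines-sign minus plus  (-<- y<x) (+<+ x<y) = ⊥-elim (<-asym x<y (s≤s y<x))

lex-first-difference : ∀ {t r} {a b : Sym t r} → a ≢ b →
  ∃ λ j → lookup a j ≢ lookup b j ×
    ∀ (u : SignVec r) → (u · a) <lex (u · b) →
      signed (lookup u j) (lookup a j) <ℤ signed (lookup u j) (lookup b j)
lex-first-difference {a = []} {[]} []≢[] = ⊥-elim ([]≢[] refl)
lex-first-difference {a = x ∷ a} {y ∷ b} xa≢yb with x ≟ y
... | no x≢y = zero , x≢y , λ where
  (s ∷ u) (this lt _) → lt
  (s ∷ u) (next eq _) → ⊥-elim (x≢y (signed-injective s eq))
... | yes refl with j , aj≢bj , decided ← lex-first-difference (xa≢yb ∘ cong (x ∷_)) =
  suc j , aj≢bj , λ where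
    (s ∷ u) (this lt _) → ⊥-elim (ℤ.<-irrefl refl lt)
    (s ∷ u) (next _ lt) → decided u lt

lex-transfer : ∀ {t r} (u v : SignVec r) {a b : Sym t r} →
  (∀ j → lookup u j ≡ lookup v j ⊎ lookup a j ≡ lookup b j) →
  (u · a) <lex (u · b) → (v · a) <lex (v · b)
lex-transfer [] [] {[]} {[]} _ (base ())
lex-transfer (s ∷ u) (s′ ∷ v) {x ∷ a} {y ∷ b} same (this lt eq) with same zero
... | inj₁ refl = this lt eq
... | inj₂ refl = ⊥-elim (ℤ.<-irrefl refl lt)
lex-transfer (s ∷ u) (s′ ∷ v) {x ∷ a} {y ∷ b} same (next eq lt) =
  next (cong (signed s′) (signed-injective s eq)) (lex-transfer u v (same ∘ suc) lt)

module Projection {t : ℕ} where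

  open import Data.List.Membership.Propositional using (_∈_)
  open import Data.List.Membership.Propositional.Properties
    using (∈-map⁺; ∈-map⁻; ∈-allFin; ∈-cartesianProductWith⁺; ∈-cartesianProductWith⁻)

  select : Side → Fin (suc t) → Fin (suc t)
  select s x = if s then x else zero

  proj : ∀ {r} → Subset r → Sym (suc t) r → Sym (suc t) r
  proj = zipWith select

  lookup-proj-inside : ∀ {r} J (a : Sym (suc t) r) {j} →
                       lookup J j ≡ inside → lookup (proj J a) j ≡ lookup a j
  lookup-proj-inside J a {j} j∈J rewrite lookup-zipWith select j J a | j∈J = refl

  lookup-proj-outside : ∀ {r} J (a : Sym (suc t) r) {j} →
                        lookup J j ≡ outside → lookup (proj J a) j ≡ zero
  lookup-proj-outside J a {j} j∉J rewrite lookup-zipWith select j J a | j∉J = refl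

  fixedPoints : ∀ {r} → Subset r → List (Sym (suc t) r)
  fixedPoints []            = [ [] ]
  fixedPoints (inside ∷ J)  = cartesianProductWith _∷_ (allFin (suc t)) (fixedPoints J)
  fixedPoints (outside ∷ J) = map (zero ∷_) (fixedPoints J)

  length-fixedPoints : ∀ {r} (J : Subset r) → length (fixedPoints J) ≡ suc t ^ ∣ J ∣
  length-fixedPoints []            = refl
  length-fixedPoints (inside ∷ J)  = trans (length-cartesianProductWith _∷_ (allFin (suc t)) (fixedPoints J))
    (cong₂ _*_ (length-tabulate {n = suc t} (λ i → i)) (length-fixedPoints J))
  length-fixedPoints (outside ∷ J) = trans (length-map (zero ∷_) (fixedPoints J)) (length-fixedPoints J)

  fixedPoints-unique : ∀ {r} (J : Subset r) → Unique (fixedPoints J)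
  fixedPoints-unique []            = All.[] ∷ []
  fixedPoints-unique (inside ∷ J)  =
    Unique.cartesianProductWith⁺ _∷_ ∷-injective (Unique.allFin⁺ (suc t)) (fixedPoints-unique J)
  fixedPoints-unique (outside ∷ J) = Unique.map⁺ ∷-injectiveʳ (fixedPoints-unique J)

  ∈-fixedPoints⁺ : ∀ {r} (J : Subset r) {a} → proj J a ≡ a → a ∈ fixedPoints J
  ∈-fixedPoints⁺ []            {[]}    _     = here refl
  ∈-fixedPoints⁺ (inside ∷ J)  {x ∷ a} fixed =
    ∈-cartesianProductWith⁺ _∷_ (∈-allFin x) (∈-fixedPoints⁺ J (∷-injectiveʳ fixed))
  ∈-fixedPoints⁺ (outside ∷ J) {x ∷ a} fixed with refl ← ∷-injectiveˡ fixed =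
    ∈-map⁺ (zero ∷_) (∈-fixedPoints⁺ J (∷-injectiveʳ fixed))

  ∈-fixedPoints⁻ : ∀ {r} (J : Subset r) {a} → a ∈ fixedPoints J → proj J a ≡ a
  ∈-fixedPoints⁻ []            {[]}    _   = refl
  ∈-fixedPoints⁻ (inside ∷ J)  {x ∷ a} a∈
    with _ , _ , _ , b∈ , refl ← ∈-cartesianProductWith⁻ _∷_ (allFin (suc t)) (fixedPoints J) a∈ =
    cong (x ∷_) (∈-fixedPoints⁻ J b∈)
  ∈-fixedPoints⁻ (outside ∷ J) {x ∷ a} a∈ with _ , b∈ , refl ← ∈-map⁻ (zero ∷_) a∈ =
    cong (zero ∷_) (∈-fixedPoints⁻ J b∈)

  fixed? : ∀ {r} (J : Subset r) a → Dec (proj J a ≡ a)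
  fixed? J a = ≡-dec _≟_ (proj J a) a

  proj-idempotent : ∀ {r} (J : Subset r) a → proj J (proj J a) ≡ proj J a
  proj-idempotent []            []      = refl
  proj-idempotent (inside ∷ J)  (x ∷ a) = cong (x ∷_) (proj-idempotent J a)
  proj-idempotent (outside ∷ J) (x ∷ a) = cong (zero ∷_) (proj-idempotent J a)

module CommonSubsequences {t r : ℕ} (π : SignVec r → List (Sym (suc t) r)) (isPi : ∀ u → IsPi u (π u))
  where

  open import Data.List.Membership.Propositional using (_∈_)
  open import Data.List.Membership.Propositional.Properties using (∈-map⁻; ∈-filter⁺; ∈-filter⁻)
  import Data.Fin.Subset as Subset
  open import Data.Vec.Properties using ([]=⇒lookup; lookup⇒[]=)
  open Lists
  open Projection

  private variable
    a b : Sym (suc t) r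
    u₀ : SignVec r
    U : List (SignVec r)
    w : List (Sym (suc t) r)

  ordered⇒lex : ∀ {u a b} → a ∷ b ∷ [] ⊆ π u → (u · a) <lex (u · b)
  ordered⇒lex {u} {a} {b} = Equivalence.to (proj₂ (proj₂ (isPi u)) a b) ∘ pair⊆⇒Precedes

  lex⇒ordered : ∀ {u a b} → (u · a) <lex (u · b) → a ∷ b ∷ [] ⊆ π u
  lex⇒ordered {u} {a} {b} = Precedes⇒pair⊆ ∘ Equivalence.from (proj₂ (proj₂ (isPi u)) a b)

  π-unique : ∀ u → Unique (π u)
  π-unique u = proj₁ (isPi u)

  ∈-π : ∀ u a → a ∈ π u
  ∈-π u = proj₁ (proj₂ (isPi u))

  commonly-ordered⇒proj-≢ : (J : Subset r) → (∀ j → Agree U j → j Subset.∈ J) → a ≢ b →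
    (∀ {u} → u ∈ U → a ∷ b ∷ [] ⊆ π u) → proj J a ≢ proj J b
  commonly-ordered⇒proj-≢ {U} {a} {b} J agree⇒∈J a≢b ordered pa≡pb
    with j , aj≢bj , decided ← lex-first-difference a≢b = aj≢bj (begin
      lookup a j          ≡⟨ sym (lookup-proj-inside J a j∈J) ⟩
      lookup (proj J a) j ≡⟨ cong (λ c → lookup c j) pa≡pb ⟩
      lookup (proj J b) j ≡⟨ lookup-proj-inside J b j∈J ⟩
      lookup b j          ∎)
    where
      open ≡-Reasoning
      agree : Agree U j
      agree u v u∈ v∈ = signed-<-determines-sign (lookup u j) (lookup v j)
        (decided u (ordered⇒lex (ordered u∈))) (decided v (ordered⇒lex (ordered v∈)))
      j∈J = []=⇒lookup (agree⇒∈J j agree)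

  common-subsequence-length≤ : (J : Subset r) → (∀ j → Agree U j → j Subset.∈ J) → u₀ ∈ U →
    CommonSubseq U π w → length w ≤ suc t ^ ∣ J ∣
  common-subsequence-length≤ {U} {u₀} {w} J agree⇒∈J u₀∈ common = begin
    length w                ≡⟨ sym (length-map (proj J) w) ⟩
    length (map (proj J) w) ≤⟨ Unique⇒length≤ (Unique-map⁺ proj-injective w-unique) ∈fixedPoints ⟩
    length (fixedPoints J)  ≡⟨ length-fixedPoints J ⟩
    suc t ^ ∣ J ∣           ∎
    where
      open ≤-Reasoning
      w-unique : Unique w
      w-unique = Unique-resp-⊆ (common u₀ u₀∈) (π-unique u₀)
      ordered : ∀ {a b u} → a ∷ b ∷ [] ⊆ w → u ∈ U → a ∷ b ∷ [] ⊆ π u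
      ordered ab u∈ = ⊆-trans ab (common _ u∈)
      proj-injective : ∀ {a b} → a ∈ w → b ∈ w → proj J a ≡ proj J b → a ≡ b
      proj-injective {a} {b} a∈ b∈ pa≡pb with ≡-dec _≟_ a b
      ... | yes a≡b = a≡b
      ... | no a≢b with pair⊆-total a∈ b∈ a≢b
      ...   | inj₁ ab = ⊥-elim (commonly-ordered⇒proj-≢ J agree⇒∈J a≢b (ordered ab) pa≡pb)
      ...   | inj₂ ba =
        ⊥-elim (commonly-ordered⇒proj-≢ J agree⇒∈J (a≢b ∘ sym) (ordered ba) (sym pa≡pb))
      ∈fixedPoints : ∀ {c} → c ∈ map (proj J) w → c ∈ fixedPoints J
      ∈fixedPoints c∈ with a , _ , refl ← ∈-map⁻ (proj J) c∈ =
        ∈-fixedPoints⁺ J (proj-idempotent J a)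

  fixedSubword : Subset r → SignVec r → List (Sym (suc t) r)
  fixedSubword J u = filter (fixed? J) (π u)

  -- Fixed symbols coincide off J, so their order in π(u) depends only on the signs of u on J.

  fixedSubword-common : (J : Subset r) → (∀ j → j Subset.∈ J → Agree U j) → u₀ ∈ U →
    CommonSubseq U π (fixedSubword J u₀)
  fixedSubword-common {U} {u₀} J ∈J⇒agree u₀∈ u u∈ = pair⊆⇒⊆
    (Unique.filter⁺ _ (π-unique u₀)) (π-unique u) (λ {a} _ → ∈-π u a) transfer
    where
      fixed : ∀ {a} → a ∈ fixedSubword J u₀ → proj J a ≡ a
      fixed = proj₂ ∘ ∈-filter⁻ (fixed? J) {xs = π u₀}
      transfer : ∀ {a b} → a ∷ b ∷ [] ⊆ fixedSubword J u₀ → a ∷ b ∷ [] ⊆ π u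
      transfer {a} {b} ab =
        lex⇒ordered (lex-transfer u₀ u same (ordered⇒lex (⊆-trans ab (filter-⊆ _ _))))
        where
          same : ∀ j → lookup u₀ j ≡ lookup u j ⊎ lookup a j ≡ lookup b j
          same j with lookup J j in Jj
          ... | inside  = inj₁ (∈J⇒agree j (lookup⇒[]= j J Jj) u₀ u u₀∈ u∈)
          ... | outside = inj₂ (trans (off a (fixed (to∈ ab))) (sym (off b (fixed (to∈ (∷ˡ⁻ ab))))))
            where
              off : ∀ c → proj J c ≡ c → lookup c j ≡ zero
              off c fixedc = trans (cong (λ d → lookup d j) (sym fixedc)) (lookup-proj-outside J c Jj)

  fixedSubword-length : (J : Subset r) (u : SignVec r) → suc t ^ ∣ J ∣ ≤ length (fixedSubword J u)
  fixedSubword-length J u = begin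
    suc t ^ ∣ J ∣                ≡⟨ sym (length-fixedPoints J) ⟩
    length (fixedPoints J)       ≤⟨ Unique⇒length≤ (fixedPoints-unique J) ∈fixedSubword ⟩
    length (fixedSubword J u)    ∎
    where
      open ≤-Reasoning
      ∈fixedSubword : ∀ {a} → a ∈ fixedPoints J → a ∈ fixedSubword J u
      ∈fixedSubword {a} a∈ = ∈-filter⁺ _ (∈-π u a) (∈-fixedPoints⁻ J a∈)

open import Data.Fin.Subset using (_∈_)

lemma12 : (t r : ℕ) → 1 ≤ t → 1 ≤ r →
    (U : List (SignVec r)) → U ≢ [] →
    (J : Subset r) → (∀ j → (j ∈ J) ⇔ Agree U j) →
    (π : SignVec r → List (Sym t r)) → (∀ u → IsPi u (π u)) →
    LCSLength U π (t ^ ∣ J ∣)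
lemma12 zero    _ () _ _ _ _ _ _ _
lemma12 (suc t) _ _ _ [] U≢[] _ _ _ _ = ⊥-elim (U≢[] refl)
lemma12 (suc t) _ _ _ U@(u₀ ∷ _) _ J J⇔agree π isPi =
  (fixedSubword J u₀ , common , ≤-antisym (bound _ common) (fixedSubword-length J u₀)) , bound
  where
    open CommonSubsequences π isPi
    common : CommonSubseq U π (fixedSubword J u₀)
    common = fixedSubword-common J (Equivalence.to ∘ J⇔agree) (here refl)
    bound : ∀ w → CommonSubseq U π w → length w ≤ suc t ^ ∣ J ∣
    bound w = common-subsequence-length≤ J (Equivalence.from ∘ J⇔agree) (here refl)
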